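{- Let $k\geq 2$ and let $G=K_{n_1,n_2,\ldots,n_k}$ be the complete $k$-partite graph with part sizes $n_1,\ldots,n_k$, where $n_i\geq 2$ for all $1\leq i\leq k$. Then $$\mathcal{R}(G)=\sum_{i=1}^k n_i\left(\frac{n_i-1}{n_i}+\sum_{t=1,\,t\neq i}^k n_t\right)^{ -1}\left(\frac{n_i-1}{2n_i}+\sum_{t=1,\,t\neq i}^k\frac{n_t}{n_i+n_t}\right).$$
   Context: All graphs are finite, simple, connected and have at least two vertices; $d(x,y)$ is the shortest-path distance and $|G|$ the number of vertices. A vertex $w$ resolves two vertices $u,v$ if $d(u,w)\neq d(v,w)$. $V_p$ is the set of all unordered pairs $(u,v)$ of distinct vertices. For $(u,v)\in V_p$, $R(u,v)=\{x\in V(G): x \text{ resolves } u,v\}$, and for $w\in V(G)$ the resolving share is $r_w(u,v)=1/|R(u,v)|$ if $w$ resolves $u,v$, and $0$ otherwise. For $w\in V(G)$, $R(w)=\{(u,v)\in V_p: w \text{ resolves } u,v\}$, $ar_w(G)=\frac{1}{|R(w)|}\sum_{(u,v)\in R(w)} r_w(u,v)$, and the resolving topological index is $\mathcal{R}(G)=\sum_{w\in V(G)} ar_w(G)$. -}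

module Defs where

open import Data.Nat as ℕ using (ℕ; zero; suc; _<ᵇ_)
open import Data.Nat.Properties as ℕP using ()
open import Data.Integer using (+_)
open import Data.Fin as Fin using (Fin; toℕ)
open import Data.Fin.Properties using () renaming (_≟_ to _≟ᶠ_)
open import Data.Bool using (Bool; true; false; if_then_else_; _∧_; _∨_; not)
open import Data.List using (List; []; _∷_; foldr; map; filter; length; allFin; concatMap)
open import Data.Bool.ListAction using (any)
open import Data.Product using (_×_; _,_; proj₁; proj₂)
open import Data.Rational using (ℚ; 0ℚ; _+_; _*_; 1/_; ≢-nonZero)
import Data.Rational as Q
open import Data.Rational.Properties using () renaming (_≟_ to _≟ℚ_)
open import Relation.Nullary using (yes; no; ¬_)
open import Relation.Nullary.Decidable using (⌊_⌋)

-- Rational helpers (with harmless 0-fallbacks, only ever used at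
-- nonzero arguments in the theorem)

inv : ℚ → ℚ
inv p with p ≟ℚ 0ℚ
... | yes _ = 0ℚ
... | no ne = 1/_ p {{≢-nonZero ne}}

_÷ℕ_ : ℕ → ℕ → ℚ
a ÷ℕ zero  = 0ℚ
a ÷ℕ suc b = (+ a) Q./ suc b

ℕ→ℚ : ℕ → ℚ
ℕ→ℚ a = (+ a) Q./ 1

sumℚ : List ℚ → ℚ
sumℚ = foldr _+_ 0ℚ

record Graph (N : ℕ) : Set where
  field
    adj : Fin N → Fin N → Bool

countF : ∀ {N} → (Fin N → Bool) → ℕ
countF {N} P = length (filter (λ x → Data.Bool._≟_ (P x) true) (allFin N))
  where import Data.Bool

module _ {N : ℕ} (G : Graph N) where
  open Graph G

  reach : ℕ → Fin N → Fin N → Bool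
  reach zero    u v = ⌊ u ≟ᶠ v ⌋
  reach (suc m) u v = reach m u v ∨ any (λ x → reach m u x ∧ adj x v) (allFin N)

  -- shortest-path distance: the least m with a walk of length ≤ m from
  -- u to v (searching m = 0,1,…,N; in a connected graph on N vertices
  -- every distance is ≤ N - 1, so the fallback value is never used).
  dist : Fin N → Fin N → ℕ
  dist u v = search N 0
    where
    search : ℕ → ℕ → ℕ
    search zero    m = m
    search (suc f) m = if reach m u v then m else search f (suc m)

  resolves : Fin N → Fin N → Fin N → Bool
  resolves w u v = not ⌊ dist u w ℕ.≟ dist v w ⌋

  -- V_p : all unordered pairs of distinct vertices, listed as (u , v)
  -- with toℕ u < toℕ v (each unordered pair exactly once)
  Vp : List (Fin N × Fin N)
  Vp = concatMap (λ u → map (u ,_) (filter (λ v → toℕ u ℕ.<? toℕ v) (allFin N))) (allFin N)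

  sizeR : Fin N → Fin N → ℕ
  sizeR u v = countF (λ w → resolves w u v)

  rshare : Fin N → Fin N → Fin N → ℚ
  rshare w u v = if resolves w u v then 1 ÷ℕ sizeR u v else 0ℚ

  Rw : Fin N → List (Fin N × Fin N)
  Rw w = filter (λ p → Data.Bool._≟_ (resolves w (proj₁ p) (proj₂ p)) true) Vp
    where import Data.Bool

  ar : Fin N → ℚ
  ar w = (1 ÷ℕ length (Rw w)) * sumℚ (map (λ p → rshare w (proj₁ p) (proj₂ p)) (Rw w))

  resolvingIndex : ℚ
  resolvingIndex = sumℚ (map ar (allFin N))

-- A labelling of the vertices Fin N by
-- parts  part : Fin N → Fin k  gives the graph in which two vertices are
-- adjacent iff they lie in different parts.  It is (a copy of)
-- K_{n_1,…,n_k} iff part i contains exactly n i vertices for every i.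

completeMultipartite : ∀ {N k} → (Fin N → Fin k) → Graph N
completeMultipartite part = record { adj = λ x y → not ⌊ part x ≟ᶠ part y ⌋ }

partSize : ∀ {N k} → (Fin N → Fin k) → Fin k → ℕ
partSize part i = countF (λ x → ⌊ part x ≟ᶠ i ⌋)

sumOthers : ∀ {k} → Fin k → (Fin k → ℚ) → ℚ
sumOthers {k} i f = sumℚ (map f (filter (λ t → Relation.Nullary.Decidable.¬? (t ≟ᶠ i)) (allFin k)))
  where import Relation.Nullary.Decidable

formula : ∀ {k} → (Fin k → ℕ) → ℚ
formula {k} n = sumℚ (map term (allFin k))
  where
  term : Fin k → ℚ
  term i =
    ℕ→ℚ (n i)
    * inv (((n i ℕ.∸ 1) ÷ℕ n i) + sumOthers i (λ t → ℕ→ℚ (n t)))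
    * (((n i ℕ.∸ 1) ÷ℕ (2 ℕ.* n i)) + sumOthers i (λ t → n t ÷ℕ (n i ℕ.+ n t)))

module Submission where

-- In G = K_{n_1,…,n_k} (k ≥ 2, every part nonempty) distinct vertices are
-- at distance 1 when in different parts and 2 when in the same part.
-- Hence R(u,v) = {u, v} for two vertices of one part and
-- R(u,v) = part(u) ∪ part(v) for vertices of parts s ≠ t, so r(u,v) is 1/2
-- resp. 1/(n_s + n_t).  Fix w in part i.  Both |R(w)| and Σ_{R(w)} r_w are
-- sums over resolved pairs of a weight that depends only on the parts of
-- the pair; such a sum is half the sum over ordered pairs, which we
-- evaluate row by row (module WeightedResolvedPairs).  This gives
--   |R(w)| = n_i − 1 + n_i Σ_{t≠i} n_t,
--   Σ_{R(w)} r_w = (n_i − 1)/2 + n_i Σ_{t≠i} n_t/(n_i + n_t),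
-- so ar_w depends only on i.  Summing over the n_i vertices of each part
-- and cancelling the common factor n_i gives the formula.

open import Defs
open import Data.Nat using (ℕ; _≤_)
open import Data.Fin using (Fin)
open import Relation.Binary.PropositionalEquality using (_≡_)

import Data.Nat as ℕ
open import Data.Nat using (zero; suc; s≤s; z≤n)
import Data.Nat.Properties as ℕP
open import Data.Nat.Coprimality using (1-coprimeTo)
import Data.Nat.Coprimality as Coprime
open import Data.Integer as ℤ using (+_)
import Data.Integer.Properties as ℤP
open import Data.Rational as ℚ using (ℚ; 0ℚ; 1ℚ; _+_; _*_; -_; toℚᵘ)
import Data.Rational.Properties as ℚP
import Data.Rational.Unnormalised as ℚᵘ
import Data.Rational.Unnormalised.Properties as ℚᵘP
open import Data.Rational.Solver using (module +-*-Solver)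
open +-*-Solver using (solve; _:+_; _:*_; :-_; _:=_; con)
open import Data.Fin as Fin using (toℕ)
open import Data.Fin.Properties using (toℕ-injective) renaming (_≟_ to _≟ᶠ_)
open import Data.Bool using (Bool; true; false; if_then_else_; not; _∧_)
import Data.Bool as Bool
open import Data.Bool.Properties using (∨-zeroʳ)
open import Data.Bool.ListAction using (any)
open import Data.List using (List; []; _∷_; map; filter; length; allFin; concatMap; concat; tabulate; _++_)
open import Data.List.Properties using (map-tabulate)
open import Data.List.Membership.Propositional using (_∈_)
open import Data.List.Membership.Propositional.Properties using (∈-allFin)
open import Data.List.Relation.Unary.Any using (here; there)
open import Data.Product using (_×_; _,_; proj₁; proj₂; ∃)
open import Relation.Binary.PropositionalEquality using (refl; cong; cong₂; trans; sym; subst; _≢_; ≢-sym; module ≡-Reasoning)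
open import Relation.Binary.Definitions using (tri<; tri≈; tri>)
open import Relation.Nullary using (yes; no; does; Dec; contradiction)
open import Relation.Nullary.Decidable using (⌊_⌋; ¬?; dec-true; dec-false)
open import Relation.Unary using (Pred; Decidable)
open import Level using (0ℓ)

toℚᵘ-ℕ→ℚ : ∀ m → toℚᵘ (ℕ→ℚ m) ℚᵘ.≃ ℚᵘ.mkℚᵘ (+ m) 0
toℚᵘ-ℕ→ℚ m rewrite ℚP.normalize-coprime (Coprime.sym (1-coprimeTo m)) = ℚᵘ.*≡* refl

ℕ→ℚ-+ : ∀ m n → ℕ→ℚ (m ℕ.+ n) ≡ ℕ→ℚ m + ℕ→ℚ n
ℕ→ℚ-+ m n = ℚP.toℚᵘ-injective (begin
  toℚᵘ (ℕ→ℚ (m ℕ.+ n))                       ≈⟨ toℚᵘ-ℕ→ℚ (m ℕ.+ n) ⟩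
  ℚᵘ.mkℚᵘ (+ (m ℕ.+ n)) 0                      ≈⟨ ℚᵘ.*≡* integers ⟩
  ℚᵘ.mkℚᵘ (+ m) 0 ℚᵘ.+ ℚᵘ.mkℚᵘ (+ n) 0         ≈⟨ ℚᵘP.+-cong (toℚᵘ-ℕ→ℚ m) (toℚᵘ-ℕ→ℚ n) ⟨
  toℚᵘ (ℕ→ℚ m) ℚᵘ.+ toℚᵘ (ℕ→ℚ n)               ≈⟨ ℚP.toℚᵘ-homo-+ (ℕ→ℚ m) (ℕ→ℚ n) ⟨
  toℚᵘ (ℕ→ℚ m + ℕ→ℚ n)                         ∎)
  where
  open ℚᵘP.≃-Reasoning
  integers : + (m ℕ.+ n) ℤ.* + 1 ≡ (+ m ℤ.* + 1 ℤ.+ + n ℤ.* + 1) ℤ.* + 1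
  integers rewrite ℤP.*-identityʳ (+ m) | ℤP.*-identityʳ (+ n)
                 | ℤP.*-identityʳ (+ (m ℕ.+ n)) = ℤP.pos-+ m n

ℕ→ℚ-suc≢0 : ∀ m → ℕ→ℚ (suc m) ≢ 0ℚ
ℕ→ℚ-suc≢0 m eq
  with () ← trans (sym (ℚP.normalize-coprime (Coprime.sym (1-coprimeTo (suc m))))) eq

two≢0 : 1ℚ + 1ℚ ≢ 0ℚ
two≢0 eq = ℕ→ℚ-suc≢0 1 (trans (ℕ→ℚ-+ 1 1) eq)

inv-inverseˡ : ∀ p → p ≢ 0ℚ → inv p * p ≡ 1ℚ
inv-inverseˡ p p≢0 with p ℚP.≟ 0ℚ
... | yes p≡0 = contradiction p≡0 p≢0
... | no p≢0′ = ℚP.*-inverseˡ p {{ℚ.≢-nonZero p≢0′}}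

*-cancelˡ-nonzero : ∀ c {x y} → c ≢ 0ℚ → c * x ≡ c * y → x ≡ y
*-cancelˡ-nonzero c {x} {y} c≢0 eq = begin
  x                  ≡⟨ solve 1 (λ x → x := con 1ℚ :* x) refl x ⟩
  1ℚ * x             ≡⟨ cong (_* x) (inv-inverseˡ c c≢0) ⟨
  (inv c * c) * x    ≡⟨ ℚP.*-assoc (inv c) c x ⟩
  inv c * (c * x)    ≡⟨ cong (inv c *_) eq ⟩
  inv c * (c * y)    ≡⟨ ℚP.*-assoc (inv c) c y ⟨
  (inv c * c) * y    ≡⟨ cong (_* y) (inv-inverseˡ c c≢0) ⟩
  1ℚ * y             ≡⟨ ℚP.*-identityˡ y ⟩
  y                  ∎
  where open ≡-Reasoning

-- inv is multiplicative as soon as one factor is nonzero (inv 0 = 0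
-- takes care of a vanishing second factor).
inv-* : ∀ p q → p ≢ 0ℚ → inv (p * q) ≡ inv p * inv q
inv-* p q p≢0 = by-cases (q ℚP.≟ 0ℚ)
  where
  open ≡-Reasoning
  by-cases : Dec (q ≡ 0ℚ) → inv (p * q) ≡ inv p * inv q
  by-cases (yes refl) = trans (cong inv (ℚP.*-zeroʳ p)) (sym (ℚP.*-zeroʳ (inv p)))
  by-cases (no q≢0) = *-cancelˡ-nonzero (p * q) pq≢0 (begin
    p * q * inv (p * q)           ≡⟨ ℚP.*-comm (p * q) _ ⟩
    inv (p * q) * (p * q)         ≡⟨ inv-inverseˡ (p * q) pq≢0 ⟩
    1ℚ                            ≡⟨ solve 0 (con 1ℚ := con 1ℚ :* con 1ℚ) refl ⟩
    1ℚ * 1ℚ                       ≡⟨ cong₂ _*_ (inv-inverseˡ p p≢0) (inv-inverseˡ q q≢0) ⟨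
    (inv p * p) * (inv q * q)     ≡⟨ solve 4 (λ p q ip iq → (ip :* p) :* (iq :* q) := p :* q :* (ip :* iq)) refl p q (inv p) (inv q) ⟩
    p * q * (inv p * inv q)       ∎)
    where
    pq≢0 : p * q ≢ 0ℚ
    pq≢0 pq≡0 = q≢0 (*-cancelˡ-nonzero p p≢0 (trans pq≡0 (sym (ℚP.*-zeroʳ p))))

-- a ÷ℕ b is the quotient a · b⁻¹ (also for b = 0, where both sides are 0).
÷ℕ≡*inv : ∀ a b → a ÷ℕ b ≡ ℕ→ℚ a * inv (ℕ→ℚ b)
÷ℕ≡*inv a zero = sym (ℚP.*-zeroʳ (ℕ→ℚ a))
÷ℕ≡*inv a (suc b) = *-cancelˡ-nonzero B (ℕ→ℚ-suc≢0 b) (begin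
  B * q                      ≡⟨ ℚP.*-comm B q ⟩
  q * B                      ≡⟨ ℚP.toℚᵘ-injective quotient-times-denominator ⟩
  ℕ→ℚ a                      ≡⟨ solve 1 (λ a → a := a :* con 1ℚ) refl (ℕ→ℚ a) ⟩
  ℕ→ℚ a * 1ℚ                 ≡⟨ cong (ℕ→ℚ a *_) (inv-inverseˡ B (ℕ→ℚ-suc≢0 b)) ⟨
  ℕ→ℚ a * (inv B * B)        ≡⟨ solve 3 (λ a iB B → a :* (iB :* B) := B :* (a :* iB)) refl (ℕ→ℚ a) (inv B) B ⟩
  B * (ℕ→ℚ a * inv B)        ∎)
  where
  open ≡-Reasoning
  q B : ℚ
  q = (+ a) ℚ./ suc b
  B = ℕ→ℚ (suc b)
  quotient-times-denominator : toℚᵘ (q * B) ℚᵘ.≃ toℚᵘ (ℕ→ℚ a)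
  quotient-times-denominator = ℚᵘP.≃-trans (ℚP.toℚᵘ-homo-* q B)
    (ℚᵘP.≃-trans (ℚᵘP.*-cong (ℚP.toℚᵘ-fromℚᵘ (ℚᵘ.mkℚᵘ (+ a) b)) (toℚᵘ-ℕ→ℚ (suc b)))
    (ℚᵘP.≃-trans (ℚᵘ.*≡* integers) (ℚᵘP.≃-sym (toℚᵘ-ℕ→ℚ a))))
    where
    integers : ((+ a) ℤ.* (+ suc b)) ℤ.* + 1 ≡ + a ℤ.* (+ (suc b ℕ.* 1))
    integers rewrite ℤP.*-identityʳ (+ a ℤ.* + suc b) | ℕP.*-identityʳ (suc b) = refl

cancel-ratio : ∀ c x y → c ≢ 0ℚ → inv (c * x) * (c * y) ≡ inv x * y
cancel-ratio c x y c≢0 = begin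
  inv (c * x) * (c * y)          ≡⟨ cong (_* (c * y)) (inv-* c x c≢0) ⟩
  inv c * inv x * (c * y)        ≡⟨ solve 4 (λ ic ix c y → ic :* ix :* (c :* y) := (ic :* c) :* (ix :* y)) refl (inv c) (inv x) c y ⟩
  (inv c * c) * (inv x * y)      ≡⟨ cong (_* (inv x * y)) (inv-inverseˡ c c≢0) ⟩
  1ℚ * (inv x * y)               ≡⟨ ℚP.*-identityˡ _ ⟩
  inv x * y                      ∎
  where open ≡-Reasoning

scale-out : ∀ {A M} x y → A ≡ 1ℚ + M → A ≢ 0ℚ → A * x + - x + A * y ≡ A * (M * (x * inv A) + y)
scale-out {A} {M} x y A≡1+M A≢0 = begin
  A * x + - x + A * y                  ≡⟨ solve 3 (λ A x y → A :* x :+ :- x :+ A :* y := (A :+ :- con 1ℚ) :* x :+ A :* y) refl A x y ⟩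
  (A + - 1ℚ) * x + A * y               ≡⟨ cong (λ z → (z + - 1ℚ) * x + A * y) A≡1+M ⟩
  ((1ℚ + M) + - 1ℚ) * x + A * y        ≡⟨ solve 4 (λ M x A y → ((con 1ℚ :+ M) :+ :- con 1ℚ) :* x :+ A :* y := M :* x :* con 1ℚ :+ A :* y) refl M x A y ⟩
  M * x * 1ℚ + A * y                   ≡⟨ cong (λ z → M * x * z + A * y) (inv-inverseˡ A A≢0) ⟨
  M * x * (inv A * A) + A * y          ≡⟨ solve 5 (λ M x iA A y → M :* x :* (iA :* A) :+ A :* y := A :* (M :* (x :* iA) :+ y)) refl M x (inv A) A y ⟩
  A * (M * (x * inv A) + y)            ∎
  where open ≡-Reasoning

∑ : ∀ {A : Set} → List A → (A → ℚ) → ℚ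
∑ xs f = sumℚ (map f xs)

ind : Bool → ℚ → ℚ
ind b x = if b then x else 0ℚ

ind-1* : ∀ b y → ind b 1ℚ * y ≡ ind b y
ind-1* true  y = ℚP.*-identityˡ y
ind-1* false y = ℚP.*-zeroˡ y

ind-idem : ∀ b x → ind b (ind b x) ≡ ind b x
ind-idem true  x = refl
ind-idem false x = refl

module _ {A : Set} where

  ∑-cong : (xs : List A) {f g : A → ℚ} → (∀ x → f x ≡ g x) → ∑ xs f ≡ ∑ xs g
  ∑-cong []       f≗g = refl
  ∑-cong (x ∷ xs) f≗g = cong₂ _+_ (f≗g x) (∑-cong xs f≗g)

  ∑-0 : (xs : List A) → ∑ xs (λ _ → 0ℚ) ≡ 0ℚ
  ∑-0 []       = refl
  ∑-0 (x ∷ xs) = cong (_+_ 0ℚ) (∑-0 xs)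

  ∑-+ : (xs : List A) (f g : A → ℚ) → ∑ xs (λ x → f x + g x) ≡ ∑ xs f + ∑ xs g
  ∑-+ []       f g = refl
  ∑-+ (x ∷ xs) f g = trans (cong (_+_ (f x + g x)) (∑-+ xs f g))
    (solve 4 (λ a b c d → (a :+ b) :+ (c :+ d) := (a :+ c) :+ (b :+ d)) refl (f x) (g x) (∑ xs f) (∑ xs g))

  ∑-* : (xs : List A) (c : ℚ) (f : A → ℚ) → ∑ xs (λ x → c * f x) ≡ c * ∑ xs f
  ∑-* []       c f = sym (ℚP.*-zeroʳ c)
  ∑-* (x ∷ xs) c f = trans (cong (_+_ (c * f x)) (∑-* xs c f)) (sym (ℚP.*-distribˡ-+ c (f x) (∑ xs f)))

  ∑-++ : (xs ys : List A) (f : A → ℚ) → ∑ (xs ++ ys) f ≡ ∑ xs f + ∑ ys f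
  ∑-++ []       ys f = sym (ℚP.+-identityˡ _)
  ∑-++ (x ∷ xs) ys f = trans (cong (_+_ (f x)) (∑-++ xs ys f)) (sym (ℚP.+-assoc (f x) _ _))

  ∑-filter : {P : Pred A 0ℓ} (P? : Decidable P) (xs : List A) (f : A → ℚ) →
             ∑ (filter P? xs) f ≡ ∑ xs (λ x → ind (does (P? x)) (f x))
  ∑-filter P? []       f = refl
  ∑-filter P? (x ∷ xs) f with does (P? x)
  ... | true  = cong (_+_ (f x)) (∑-filter P? xs f)
  ... | false = trans (∑-filter P? xs f) (sym (ℚP.+-identityˡ _))

  length-filter : {P : Pred A 0ℓ} (P? : Decidable P) (xs : List A) →
                  ℕ→ℚ (length (filter P? xs)) ≡ ∑ xs (λ x → ind (does (P? x)) 1ℚ)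
  length-filter P? []       = refl
  length-filter P? (x ∷ xs) with does (P? x)
  ... | true  = trans (ℕ→ℚ-+ 1 (length (filter P? xs))) (cong (_+_ 1ℚ) (length-filter P? xs))
  ... | false = trans (length-filter P? xs) (sym (ℚP.+-identityˡ _))

module _ {A B : Set} where

  ∑-map : (h : A → B) (xs : List A) (f : B → ℚ) → ∑ (map h xs) f ≡ ∑ xs (λ x → f (h x))
  ∑-map h []       f = refl
  ∑-map h (x ∷ xs) f = cong (_+_ (f (h x))) (∑-map h xs f)

  ∑-concatMap : (g : A → List B) (xs : List A) (f : B → ℚ) →
                ∑ (concatMap g xs) f ≡ ∑ xs (λ x → ∑ (g x) f)
  ∑-concatMap g []       f = refl
  ∑-concatMap g (x ∷ xs) f =
    trans (∑-++ (g x) (concat (map g xs)) f) (cong (_+_ (∑ (g x) f)) (∑-concatMap g xs f))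

  ∑-swap : (xs : List A) (ys : List B) (f : A → B → ℚ) →
           ∑ xs (λ x → ∑ ys (f x)) ≡ ∑ ys (λ y → ∑ xs (λ x → f x y))
  ∑-swap []       ys f = sym (∑-0 ys)
  ∑-swap (x ∷ xs) ys f =
    trans (cong (_+_ (∑ ys (f x))) (∑-swap xs ys f)) (sym (∑-+ ys (f x) (λ y → ∑ xs (λ x → f x y))))

eqF : ∀ {n} → Fin n → Fin n → Bool
eqF x y = ⌊ x ≟ᶠ y ⌋

eqF-refl : ∀ {n} (x : Fin n) → eqF x x ≡ true
eqF-refl x with x ≟ᶠ x
... | yes _   = refl
... | no x≢x = contradiction refl x≢x

eqF-≢ : ∀ {n} {x y : Fin n} → x ≢ y → eqF x y ≡ false
eqF-≢ {x = x} {y} x≢y with x ≟ᶠ y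
... | yes x≡y = contradiction x≡y x≢y
... | no _    = refl

eqF-≡ : ∀ {n} {x y : Fin n} → x ≡ y → eqF x y ≡ true
eqF-≡ refl = eqF-refl _

eqF-sym : ∀ {n} (x y : Fin n) → eqF x y ≡ eqF y x
eqF-sym x y with x ≟ᶠ y | y ≟ᶠ x
... | yes _   | yes _   = refl
... | no _    | no _    = refl
... | yes x≡y | no y≢x  = contradiction (sym x≡y) y≢x
... | no x≢y  | yes y≡x = contradiction (sym y≡x) x≢y

∑-allFin-suc : ∀ n (f : Fin (suc n) → ℚ) → ∑ (allFin (suc n)) f ≡ f Fin.zero + ∑ (allFin n) (λ x → f (Fin.suc x))
∑-allFin-suc n f = cong (_+_ (f Fin.zero)) (begin
  ∑ (tabulate Fin.suc) f          ≡⟨ cong (λ xs → ∑ xs f) (map-tabulate (λ x → x) Fin.suc) ⟨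
  ∑ (map Fin.suc (allFin n)) f    ≡⟨ ∑-map Fin.suc (allFin n) f ⟩
  ∑ (allFin n) (λ x → f (Fin.suc x)) ∎)
  where open ≡-Reasoning

∑-delta : ∀ n (a : Fin n) (c : Fin n → ℚ) → ∑ (allFin n) (λ x → ind (eqF x a) (c x)) ≡ c a
∑-delta (suc n) Fin.zero c = begin
  _                        ≡⟨ ∑-allFin-suc n (λ x → ind (eqF x Fin.zero) (c x)) ⟩
  c Fin.zero + ∑ (allFin n) (λ _ → 0ℚ)  ≡⟨ cong (_+_ (c Fin.zero)) (∑-0 (allFin n)) ⟩
  c Fin.zero + 0ℚ          ≡⟨ ℚP.+-identityʳ (c Fin.zero) ⟩
  c Fin.zero               ∎
  where open ≡-Reasoning
∑-delta (suc n) (Fin.suc a) c = begin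
  _                        ≡⟨ ∑-allFin-suc n (λ x → ind (eqF x (Fin.suc a)) (c x)) ⟩
  0ℚ + ∑ (allFin n) (λ x → ind (eqF (Fin.suc x) (Fin.suc a)) (c (Fin.suc x)))
                           ≡⟨ ℚP.+-identityˡ _ ⟩
  ∑ (allFin n) (λ x → ind (eqF (Fin.suc x) (Fin.suc a)) (c (Fin.suc x)))
                           ≡⟨ ∑-cong (allFin n) (λ x → cong (λ b → ind b (c (Fin.suc x))) (eqF-suc x a)) ⟩
  ∑ (allFin n) (λ x → ind (eqF x a) (c (Fin.suc x)))
                           ≡⟨ ∑-delta n a (λ x → c (Fin.suc x)) ⟩
  c (Fin.suc a)            ∎
  where
  open ≡-Reasoning
  eqF-suc : ∀ {n} (x a : Fin n) → eqF (Fin.suc x) (Fin.suc a) ≡ eqF x a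
  eqF-suc x a with x ≟ᶠ a
  ... | yes _ = refl
  ... | no _  = refl

does-≟true : ∀ b → does (b Bool.≟ true) ≡ b
does-≟true true  = refl
does-≟true false = refl

countF-∑ : ∀ {N} (P : Fin N → Bool) → ℕ→ℚ (countF P) ≡ ∑ (allFin N) (λ x → ind (P x) 1ℚ)
countF-∑ {N} P = trans (length-filter (λ x → P x Bool.≟ true) (allFin N))
  (∑-cong (allFin N) (λ x → cong (λ b → ind b 1ℚ) (does-≟true (P x))))

∑-fibres : ∀ {N k} (part : Fin N → Fin k) (g : Fin k → ℚ) →
  ∑ (allFin N) (λ x → g (part x)) ≡ ∑ (allFin k) (λ t → ℕ→ℚ (partSize part t) * g t)
∑-fibres {N} {k} part g = sym (begin
  ∑ (allFin k) (λ t → ℕ→ℚ (partSize part t) * g t)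
    ≡⟨ ∑-cong (allFin k) (λ t → trans (cong (_* g t) (countF-∑ (λ x → eqF (part x) t))) (ℚP.*-comm _ (g t))) ⟩
  ∑ (allFin k) (λ t → g t * ∑ (allFin N) (λ x → ind (eqF (part x) t) 1ℚ))
    ≡⟨ ∑-cong (allFin k) (λ t → sym (∑-* (allFin N) (g t) _)) ⟩
  ∑ (allFin k) (λ t → ∑ (allFin N) (λ x → g t * ind (eqF (part x) t) 1ℚ))
    ≡⟨ ∑-swap (allFin k) (allFin N) _ ⟩
  ∑ (allFin N) (λ x → ∑ (allFin k) (λ t → g t * ind (eqF (part x) t) 1ℚ))
    ≡⟨ ∑-cong (allFin N) (λ x → ∑-cong (allFin k) (λ t → bracket x t)) ⟩
  ∑ (allFin N) (λ x → ∑ (allFin k) (λ t → ind (eqF t (part x)) (g t)))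
    ≡⟨ ∑-cong (allFin N) (λ x → ∑-delta k (part x) g) ⟩
  ∑ (allFin N) (λ x → g (part x)) ∎)
  where
  open ≡-Reasoning
  bracket : ∀ x t → g t * ind (eqF (part x) t) 1ℚ ≡ ind (eqF t (part x)) (g t)
  bracket x t = trans (ℚP.*-comm (g t) _)
    (trans (ind-1* _ (g t)) (cong (λ b → ind b (g t)) (eqF-sym (part x) t)))

module _ {k : ℕ} (i : Fin k) where

  private
    others : List (Fin k)
    others = filter (λ t → ¬? (t ≟ᶠ i)) (allFin k)

  ∑-split : (f : Fin k → ℚ) → ∑ (allFin k) f ≡ f i + sumOthers i f
  ∑-split f = begin
    ∑ (allFin k) f
      ≡⟨ ∑-cong (allFin k) (λ t → split-bracket (eqF t i) (f t)) ⟩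
    ∑ (allFin k) (λ t → ind (eqF t i) (f t) + ind (not (eqF t i)) (f t))
      ≡⟨ ∑-+ (allFin k) _ _ ⟩
    ∑ (allFin k) (λ t → ind (eqF t i) (f t)) + ∑ (allFin k) (λ t → ind (not (eqF t i)) (f t))
      ≡⟨ cong₂ _+_ (∑-delta k i f) (∑-cong (allFin k) (λ t → cong (λ b → ind b (f t)) (does-≢ t))) ⟩
    f i + ∑ (allFin k) (λ t → ind (does (¬? (t ≟ᶠ i))) (f t))
      ≡⟨ cong (_+_ (f i)) (∑-filter (λ t → ¬? (t ≟ᶠ i)) (allFin k) f) ⟨
    f i + sumOthers i f ∎
    where
    open ≡-Reasoning
    split-bracket : ∀ b x → x ≡ ind b x + ind (not b) x
    split-bracket true  x = sym (ℚP.+-identityʳ x)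
    split-bracket false x = sym (ℚP.+-identityˡ x)
    does-≢ : ∀ t → not (eqF t i) ≡ does (¬? (t ≟ᶠ i))
    does-≢ t with t ≟ᶠ i
    ... | yes _ = refl
    ... | no _  = refl

  sumOthers-cong : {f g : Fin k → ℚ} → (∀ t → t ≢ i → f t ≡ g t) → sumOthers i f ≡ sumOthers i g
  sumOthers-cong {f} {g} f≗g = begin
    ∑ others f                                            ≡⟨ ∑-filter (λ t → ¬? (t ≟ᶠ i)) (allFin k) f ⟩
    ∑ (allFin k) (λ t → ind (does (¬? (t ≟ᶠ i))) (f t))   ≡⟨ ∑-cong (allFin k) pointwise ⟩
    ∑ (allFin k) (λ t → ind (does (¬? (t ≟ᶠ i))) (g t))   ≡⟨ ∑-filter (λ t → ¬? (t ≟ᶠ i)) (allFin k) g ⟨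
    ∑ others g                                            ∎
    where
    open ≡-Reasoning
    pointwise : ∀ t → ind (does (¬? (t ≟ᶠ i))) (f t) ≡ ind (does (¬? (t ≟ᶠ i))) (g t)
    pointwise t with t ≟ᶠ i
    ... | yes _   = refl
    ... | no t≢i = f≗g t t≢i

  sumOthers-* : (c : ℚ) (f : Fin k → ℚ) → sumOthers i (λ t → c * f t) ≡ c * sumOthers i f
  sumOthers-* = ∑-* others

  sumOthers-0 : sumOthers i (λ _ → 0ℚ) ≡ 0ℚ
  sumOthers-0 = ∑-0 others

any-true : ∀ {A : Set} (P : A → Bool) {x} {xs : List A} → x ∈ xs → P x ≡ true → any P xs ≡ true
any-true P (here refl) Px rewrite Px = refl
any-true P {xs = y ∷ _} (there x∈xs) Px rewrite any-true P x∈xs Px = ∨-zeroʳ (P y)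

any-false : ∀ {A : Set} (P : A → Bool) (xs : List A) → (∀ x → P x ≡ false) → any P xs ≡ false
any-false P []       ¬P = refl
any-false P (y ∷ xs) ¬P rewrite ¬P y = any-false P xs ¬P

dist-self : ∀ {N} (G : Graph N) u → dist G u u ≡ 0
dist-self {suc _} G u rewrite eqF-refl u = refl

dist-1 : ∀ {N} (G : Graph N) {u v} → u ≢ v → reach G 1 u v ≡ true → dist G u v ≡ 1
dist-1 {suc zero}    G {Fin.zero} {Fin.zero} u≢v _ = contradiction refl u≢v
dist-1 {suc (suc _)} G u≢v reach₁ rewrite eqF-≢ u≢v | reach₁ = refl

dist-2 : ∀ {N} (G : Graph N) {u v} → u ≢ v → reach G 1 u v ≡ false → reach G 2 u v ≡ true → dist G u v ≡ 2
dist-2 {suc zero}          G {Fin.zero} {Fin.zero} u≢v _ _ = contradiction refl u≢v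
dist-2 {suc (suc zero)}    G u≢v ¬reach₁ _ rewrite eqF-≢ u≢v | ¬reach₁ = refl
dist-2 {suc (suc (suc _))} G u≢v ¬reach₁ reach₂ rewrite eqF-≢ u≢v | ¬reach₁ | reach₂ = refl

resolves-by-dist : ∀ {N} (G : Graph N) {w u v a b} → dist G u w ≡ a → dist G v w ≡ b →
                   resolves G w u v ≡ not ⌊ a ℕ.≟ b ⌋
resolves-by-dist G du dv rewrite du | dv = refl

resolves-diag : ∀ {N} (G : Graph N) w u → resolves G w u u ≡ false
resolves-diag G w u with dist G u w ℕ.≟ dist G u w
... | yes _  = refl
... | no d≢d = contradiction refl d≢d

resolves-sym : ∀ {N} (G : Graph N) w u v → resolves G w u v ≡ resolves G w v u
resolves-sym G w u v with dist G u w ℕ.≟ dist G v w | dist G v w ℕ.≟ dist G u w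
... | yes _  | yes _  = refl
... | no _   | no _   = refl
... | yes eq | no ne  = contradiction (sym eq) ne
... | no ne  | yes eq = contradiction (sym eq) ne

|R|-sym : ∀ {N} (G : Graph N) u v → ℕ→ℚ (sizeR G u v) ≡ ℕ→ℚ (sizeR G v u)
|R|-sym {N} G u v = begin
  ℕ→ℚ (sizeR G u v)                                ≡⟨ countF-∑ (λ x → resolves G x u v) ⟩
  ∑ (allFin N) (λ x → ind (resolves G x u v) 1ℚ)   ≡⟨ ∑-cong (allFin N) (λ x → cong (λ b → ind b 1ℚ) (resolves-sym G x u v)) ⟩
  ∑ (allFin N) (λ x → ind (resolves G x v u) 1ℚ)   ≡⟨ countF-∑ (λ x → resolves G x v u) ⟨
  ℕ→ℚ (sizeR G v u)                                ∎
  where open ≡-Reasoning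

-- Every vertex has a vertex outside its own part; this holds for the
-- graphs of the theorem (k ≥ 2 nonempty parts) and makes the diameter 2.
Spread : ∀ {N k} → (Fin N → Fin k) → Set
Spread part = ∀ u → ∃ λ x → part x ≢ part u

module MultipartiteDistances {N k : ℕ} (part : Fin N → Fin k) (spread : Spread part) where

  G : Graph N
  G = completeMultipartite part

  private
    adj-cross : ∀ {x y} → part x ≢ part y → Graph.adj G x y ≡ true
    adj-cross x≁y rewrite eqF-≢ x≁y = refl

    adj-mate : ∀ {x y} → part x ≡ part y → Graph.adj G x y ≡ false
    adj-mate x∼y rewrite eqF-≡ x∼y = refl

    reach₁-cross : ∀ {u v} → part u ≢ part v → reach G 1 u v ≡ true
    reach₁-cross {u} {v} u≁v
      rewrite any-true (λ x → reach G 0 u x ∧ Graph.adj G x v) (∈-allFin u)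
                (trans (cong (_∧ Graph.adj G u v) (eqF-refl u)) (adj-cross u≁v))
      = ∨-zeroʳ _

    reach₁-mate : ∀ {u v} → u ≢ v → part u ≡ part v → reach G 1 u v ≡ false
    reach₁-mate {u} {v} u≢v u∼v rewrite eqF-≢ u≢v = any-false _ (allFin N) no-step
      where
      no-step : ∀ x → (reach G 0 u x ∧ Graph.adj G x v) ≡ false
      no-step x with u ≟ᶠ x
      ... | yes refl = adj-mate u∼v
      ... | no _     = refl

    -- a path u – x – v through a vertex x of another part
    reach₂-mate : ∀ {u v} → part u ≡ part v → reach G 2 u v ≡ true
    reach₂-mate {u} {v} u∼v with spread u
    ... | x , x≁u
      rewrite any-true (λ y → reach G 1 u y ∧ Graph.adj G y v) (∈-allFin x)
                (trans (cong (_∧ Graph.adj G x v) (reach₁-cross (λ eq → x≁u (sym eq))))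
                       (adj-cross (λ eq → x≁u (trans eq (sym u∼v)))))
      = ∨-zeroʳ _

  dist-cross : ∀ {u v} → part u ≢ part v → dist G u v ≡ 1
  dist-cross u≁v = dist-1 G (λ u≡v → u≁v (cong part u≡v)) (reach₁-cross u≁v)

  dist-mate : ∀ {u v} → u ≢ v → part u ≡ part v → dist G u v ≡ 2
  dist-mate u≢v u∼v = dist-2 G u≢v (reach₁-mate u≢v u∼v) (reach₂-mate u∼v)

module _ {N : ℕ} (G : Graph N) (h : Fin N → Fin N → ℚ)
         (h-sym : ∀ u v → h u v ≡ h v u) (h-diag : ∀ u → h u u ≡ 0ℚ) where

  private
    below : Fin N → Fin N → ℚ
    below u v = ind (does (toℕ u ℕ.<? toℕ v)) (h u v)

    -- each ordered pair is, up to symmetry, the listed pair or on the diagonal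
    split-pair : ∀ u v → h u v ≡ below u v + below v u
    split-pair u v with ℕP.<-cmp (toℕ u) (toℕ v)
    ... | tri< u<v _ v≮u rewrite dec-true (toℕ u ℕ.<? toℕ v) u<v | dec-false (toℕ v ℕ.<? toℕ u) v≮u =
      sym (ℚP.+-identityʳ _)
    ... | tri> u≮v _ v<u rewrite dec-false (toℕ u ℕ.<? toℕ v) u≮v | dec-true (toℕ v ℕ.<? toℕ u) v<u =
      trans (h-sym u v) (sym (ℚP.+-identityˡ _))
    ... | tri≈ u≮u u≡v _ with toℕ-injective u≡v
    ... | refl rewrite dec-false (toℕ u ℕ.<? toℕ u) u≮u = h-diag u

    ∑-Vp : ∑ (Vp G) (λ p → h (proj₁ p) (proj₂ p)) ≡ ∑ (allFin N) (λ u → ∑ (allFin N) (below u))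
    ∑-Vp = trans (∑-concatMap above (allFin N) (λ p → h (proj₁ p) (proj₂ p))) (∑-cong (allFin N) (λ u →
      trans (∑-map (u ,_) (later u) (λ p → h (proj₁ p) (proj₂ p))) (∑-filter (λ v → toℕ u ℕ.<? toℕ v) (allFin N) (h u))))
      where
      later : Fin N → List (Fin N)
      later u = filter (λ v → toℕ u ℕ.<? toℕ v) (allFin N)
      above : Fin N → List (Fin N × Fin N)
      above u = map (u ,_) (later u)

  ∑-ordered-pairs : ∑ (allFin N) (λ u → ∑ (allFin N) (h u)) ≡ (1ℚ + 1ℚ) * ∑ (Vp G) (λ p → h (proj₁ p) (proj₂ p))
  ∑-ordered-pairs = begin
    ∑ (allFin N) (λ u → ∑ (allFin N) (h u))
      ≡⟨ ∑-cong (allFin N) (λ u → trans (∑-cong (allFin N) (split-pair u)) (∑-+ (allFin N) (below u) (λ v → below v u))) ⟩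
    ∑ (allFin N) (λ u → B u + ∑ (allFin N) (λ v → below v u))
      ≡⟨ ∑-+ (allFin N) B _ ⟩
    ∑ (allFin N) B + ∑ (allFin N) (λ u → ∑ (allFin N) (λ v → below v u))
      ≡⟨ cong (_+_ (∑ (allFin N) B)) (∑-swap (allFin N) (allFin N) (λ u v → below v u)) ⟩
    ∑ (allFin N) B + ∑ (allFin N) B
      ≡⟨ solve 1 (λ x → x :+ x := (con 1ℚ :+ con 1ℚ) :* x) refl (∑ (allFin N) B) ⟩
    (1ℚ + 1ℚ) * ∑ (allFin N) B
      ≡⟨ cong ((1ℚ + 1ℚ) *_) ∑-Vp ⟨
    (1ℚ + 1ℚ) * ∑ (Vp G) (λ p → h (proj₁ p) (proj₂ p)) ∎
    where
    open ≡-Reasoning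
    B : Fin N → ℚ
    B u = ∑ (allFin N) (below u)

formula-term : ∀ {k} → (Fin k → ℕ) → Fin k → ℚ
formula-term n i =
  ℕ→ℚ (n i)
  * inv (((n i ℕ.∸ 1) ÷ℕ n i) + sumOthers i (λ t → ℕ→ℚ (n t)))
  * (((n i ℕ.∸ 1) ÷ℕ (2 ℕ.* n i)) + sumOthers i (λ t → n t ÷ℕ (n i ℕ.+ n t)))

module ResolvingMultipartite {N k : ℕ} (part : Fin N → Fin k) (spread : Spread part)
                             (n : Fin k → ℕ) (sizes : ∀ t → partSize part t ≡ n t) where

  open MultipartiteDistances part spread

  a : Fin k → ℚ
  a t = ℕ→ℚ (n t)

  ∑-parts : (g : Fin k → ℚ) → ∑ (allFin N) (λ x → g (part x)) ≡ ∑ (allFin k) (λ t → a t * g t)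
  ∑-parts g = trans (∑-fibres part g) (∑-cong (allFin k) (λ t → cong (λ m → ℕ→ℚ m * g t) (sizes t)))

  private
    part-count : ∀ s → ∑ (allFin N) (λ x → ind (eqF (part x) s) 1ℚ) ≡ a s
    part-count s = trans (∑-parts (λ t → ind (eqF t s) 1ℚ))
      (trans (∑-cong (allFin k) (λ t → trans (ℚP.*-comm (a t) _) (ind-1* (eqF t s) (a t)))) (∑-delta k s a))

    one : Fin N → ℚ
    one _ = 1ℚ

    resolvers-mate : ∀ {u v} → u ≢ v → part u ≡ part v →
      ∀ x → ind (resolves G x u v) 1ℚ ≡ ind (eqF x u) 1ℚ + ind (eqF x v) 1ℚ
    resolvers-mate {u} {v} u≢v u∼v x with x ≟ᶠ u
    ... | yes refl rewrite resolves-by-dist G (dist-self G x) (dist-mate (≢-sym u≢v) (sym u∼v)) | eqF-≢ u≢v = refl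
    ... | no x≢u with x ≟ᶠ v
    ... | yes refl rewrite resolves-by-dist G (dist-mate u≢v u∼v) (dist-self G x) = refl
    ... | no x≢v with part x ≟ᶠ part u
    ... | yes x∼u rewrite resolves-by-dist G (dist-mate (≢-sym x≢u) (sym x∼u))
                                             (dist-mate (≢-sym x≢v) (trans (sym u∼v) (sym x∼u))) = refl
    ... | no x≁u rewrite resolves-by-dist G (dist-cross (≢-sym x≁u))
                                            (dist-cross (λ eq → x≁u (trans (sym eq) (sym u∼v)))) = refl

    resolvers-cross : ∀ {u v} → part u ≢ part v →
      ∀ x → ind (resolves G x u v) 1ℚ ≡ ind (eqF (part x) (part u)) 1ℚ + ind (eqF (part x) (part v)) 1ℚ
    resolvers-cross {u} {v} u≁v x with x ≟ᶠ u
    ... | yes refl rewrite resolves-by-dist G (dist-self G x) (dist-cross (≢-sym u≁v))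
                         | eqF-refl (part x) | eqF-≢ u≁v = refl
    ... | no x≢u with x ≟ᶠ v
    ... | yes refl rewrite resolves-by-dist G (dist-cross u≁v) (dist-self G x)
                         | eqF-refl (part x) | eqF-≢ (≢-sym u≁v) = refl
    ... | no x≢v with part x ≟ᶠ part u
    ... | yes x∼u rewrite resolves-by-dist G (dist-mate (≢-sym x≢u) (sym x∼u))
                                             (dist-cross (λ eq → u≁v (trans (sym x∼u) (sym eq))))
                        | eqF-≢ (λ eq → u≁v (trans (sym x∼u) eq)) = refl
    ... | no x≁u with part x ≟ᶠ part v
    ... | yes x∼v rewrite resolves-by-dist G (dist-cross (≢-sym x≁u)) (dist-mate (≢-sym x≢v) (sym x∼v)) = refl
    ... | no x≁v rewrite resolves-by-dist G (dist-cross (≢-sym x≁u)) (dist-cross (≢-sym x≁v)) = refl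

  |R|-mate : ∀ {u v} → u ≢ v → part u ≡ part v → ℕ→ℚ (sizeR G u v) ≡ 1ℚ + 1ℚ
  |R|-mate {u} {v} u≢v u∼v = begin
    ℕ→ℚ (sizeR G u v)                                              ≡⟨ countF-∑ (λ x → resolves G x u v) ⟩
    ∑ (allFin N) (λ x → ind (resolves G x u v) 1ℚ)                 ≡⟨ ∑-cong (allFin N) (resolvers-mate u≢v u∼v) ⟩
    ∑ (allFin N) (λ x → ind (eqF x u) 1ℚ + ind (eqF x v) 1ℚ)       ≡⟨ ∑-+ (allFin N) _ _ ⟩
    _                                                              ≡⟨ cong₂ _+_ (∑-delta N u one) (∑-delta N v one) ⟩
    1ℚ + 1ℚ                                                        ∎
    where open ≡-Reasoning

  |R|-cross : ∀ {u v} → part u ≢ part v → ℕ→ℚ (sizeR G u v) ≡ a (part u) + a (part v)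
  |R|-cross {u} {v} u≁v = begin
    ℕ→ℚ (sizeR G u v)                                  ≡⟨ countF-∑ (λ x → resolves G x u v) ⟩
    ∑ (allFin N) (λ x → ind (resolves G x u v) 1ℚ)     ≡⟨ ∑-cong (allFin N) (resolvers-cross u≁v) ⟩
    _                                                  ≡⟨ ∑-+ (allFin N) _ _ ⟩
    _                                                  ≡⟨ cong₂ _+_ (part-count (part u)) (part-count (part v)) ⟩
    a (part u) + a (part v)                            ∎
    where open ≡-Reasoning

  -- Fix w in part i.  For a pair weight c that equals α on pairs inside
  -- a part and β(s,t) on pairs from parts s ≠ t (β symmetric), the sum of
  -- c over the ordered pairs resolved by w is
  --     2 · (n_i α − α + n_i Σ_{t≠i} n_t β(i,t)),
  -- obtained by computing each row sum Σ_v [w resolves u,v]·c(u,v) in the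
  -- three cases u = w, u a mate of w, u outside part i.
  module WeightedResolvedPairs (w : Fin N) (α : ℚ) (β : Fin k → Fin k → ℚ) (c : Fin N → Fin N → ℚ)
    (c-mate : ∀ {u v} → u ≢ v → part u ≡ part v → c u v ≡ α)
    (c-cross : ∀ {u v} → part u ≢ part v → c u v ≡ β (part u) (part v))
    (β-sym : ∀ s t → β s t ≡ β t s) where

    i : Fin k
    i = part w

    h : Fin N → Fin N → ℚ
    h u v = ind (resolves G w u v) (c u v)

    B : ℚ
    B = sumOthers i (λ t → a t * β i t)

    ∑ᵥ : (Fin N → ℚ) → ℚ
    ∑ᵥ = ∑ (allFin N)

    private
      if-refl : ∀ {A : Set} (x : A) {y : A} → (if eqF i i then x else y) ≡ x
      if-refl x rewrite eqF-refl i = refl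

      row-shape : (g : Fin k → ℚ) (δ : ℚ) →
        ∑ᵥ (λ v → g (part v) + ind (eqF v w) δ) ≡ (a i * g i + sumOthers i (λ t → a t * g t)) + δ
      row-shape g δ = trans (∑-+ (allFin N) _ _)
        (cong₂ _+_ (trans (∑-parts g) (∑-split i (λ t → a t * g t))) (∑-delta N w (λ _ → δ)))

      -- the profile of row u = w: v ≠ w is resolved always (0 ≠ 1, 2)
      g-self : Fin k → ℚ
      g-self t = if eqF t i then α else β i t

      entries-self : ∀ v → h w v ≡ g-self (part v) + ind (eqF v w) (- α)
      entries-self v with v ≟ᶠ w
      ... | yes refl rewrite resolves-by-dist G (dist-self G v) (dist-self G v) | eqF-refl (part v) =
        sym (ℚP.+-inverseʳ α)
      ... | no v≢w with part v ≟ᶠ i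
      ... | yes v∼w rewrite resolves-by-dist G (dist-self G w) (dist-mate v≢w v∼w) =
        trans (c-mate (≢-sym v≢w) (sym v∼w)) (sym (ℚP.+-identityʳ α))
      ... | no v≁w rewrite resolves-by-dist G (dist-self G w) (dist-cross v≁w) =
        trans (c-cross (≢-sym v≁w)) (sym (ℚP.+-identityʳ _))

      -- row u for a mate u of w: only v = w and v outside part i (2 ≠ 0, 1)
      g-mate : Fin k → ℚ
      g-mate t = if eqF t i then 0ℚ else β i t

      entries-mate : ∀ {u} → u ≢ w → part u ≡ i → ∀ v → h u v ≡ g-mate (part v) + ind (eqF v w) α
      entries-mate {u} u≢w u∼w v with v ≟ᶠ w
      ... | yes refl rewrite resolves-by-dist G (dist-mate u≢w u∼w) (dist-self G v) | eqF-refl (part v) =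
        trans (c-mate u≢w u∼w) (sym (ℚP.+-identityˡ α))
      ... | no v≢w with part v ≟ᶠ i
      ... | yes v∼w rewrite resolves-by-dist G (dist-mate u≢w u∼w) (dist-mate v≢w v∼w) = refl
      ... | no v≁w rewrite resolves-by-dist G (dist-mate u≢w u∼w) (dist-cross v≁w) =
        trans (c-cross (λ eq → v≁w (trans (sym eq) u∼w)))
              (trans (cong (λ s → β s (part v)) u∼w) (sym (ℚP.+-identityʳ _)))

      -- row u for u outside part i: only v in part i (1 ≠ 0, 2)
      g-cross : Fin k → Fin k → ℚ
      g-cross s t = if eqF t i then β s i else 0ℚ

      entries-cross : ∀ {u} → part u ≢ i → ∀ v → h u v ≡ g-cross (part u) (part v)
      entries-cross {u} u≁w v with v ≟ᶠ w
      ... | yes refl rewrite resolves-by-dist G (dist-cross u≁w) (dist-self G v) | eqF-refl (part v) =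
        c-cross u≁w
      ... | no v≢w with part v ≟ᶠ i
      ... | yes v∼w rewrite resolves-by-dist G (dist-cross u≁w) (dist-mate v≢w v∼w) =
        trans (c-cross (λ eq → u≁w (trans eq v∼w))) (cong (β (part u)) v∼w)
      ... | no v≁w rewrite resolves-by-dist G (dist-cross u≁w) (dist-cross v≁w) = refl

      row-self : ∑ᵥ (h w) ≡ (a i * α + B) + - α
      row-self = trans (∑-cong (allFin N) entries-self) (trans (row-shape g-self (- α))
        (cong₂ (λ x y → (a i * x + y) + - α) (if-refl α) (sumOthers-cong i off-i)))
        where
        off-i : ∀ t → t ≢ i → a t * g-self t ≡ a t * β i t
        off-i t t≢i rewrite eqF-≢ t≢i = refl

      row-mate : ∀ {u} → u ≢ w → part u ≡ i → ∑ᵥ (h u) ≡ (a i * 0ℚ + B) + α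
      row-mate u≢w u∼w = trans (∑-cong (allFin N) (entries-mate u≢w u∼w)) (trans (row-shape g-mate α)
        (cong₂ (λ x y → (a i * x + y) + α) (if-refl 0ℚ) (sumOthers-cong i off-i)))
        where
        off-i : ∀ t → t ≢ i → a t * g-mate t ≡ a t * β i t
        off-i t t≢i rewrite eqF-≢ t≢i = refl

      row-cross : ∀ {u} → part u ≢ i → ∑ᵥ (h u) ≡ a i * β (part u) i
      row-cross {u} u≁w = begin
        ∑ᵥ (h u)                                                   ≡⟨ ∑-cong (allFin N) (entries-cross u≁w) ⟩
        ∑ᵥ (λ v → g-cross (part u) (part v))                       ≡⟨ ∑-parts (g-cross (part u)) ⟩
        ∑ (allFin k) (λ t → a t * g-cross (part u) t)              ≡⟨ ∑-split i _ ⟩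
        a i * g-cross (part u) i + sumOthers i (λ t → a t * g-cross (part u) t)
          ≡⟨ cong₂ (λ x y → a i * x + y) (if-refl (β (part u) i)) (trans (sumOthers-cong i off-i) (sumOthers-0 i)) ⟩
        a i * β (part u) i + 0ℚ                                    ≡⟨ ℚP.+-identityʳ _ ⟩
        a i * β (part u) i                                         ∎
        where
        open ≡-Reasoning
        off-i : ∀ t → t ≢ i → a t * g-cross (part u) t ≡ 0ℚ
        off-i t t≢i rewrite eqF-≢ t≢i = ℚP.*-zeroʳ (a t)

      -- every row sum depends only on the part of u, except for u = w
      g-row : Fin k → ℚ
      g-row t = if eqF t i then α + B else a i * β t i

      Δ : ℚ
      Δ = a i * α + - α + - α

      row : ∀ u → ∑ᵥ (h u) ≡ g-row (part u) + ind (eqF u w) Δ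
      row u with u ≟ᶠ w
      ... | yes refl rewrite eqF-refl i = trans row-self
        (solve 3 (λ A α B → (A :* α :+ B) :+ (:- α) := (α :+ B) :+ (A :* α :+ :- α :+ :- α)) refl (a i) α B)
      ... | no u≢w with part u ≟ᶠ i
      ... | yes u∼w = trans (row-mate u≢w u∼w)
        (solve 3 (λ A α B → (A :* con 0ℚ :+ B) :+ α := (α :+ B) :+ con 0ℚ) refl (a i) α B)
      ... | no u≁w = trans (row-cross u≁w) (sym (ℚP.+-identityʳ _))

    ∑-resolved : ∑ᵥ (λ u → ∑ᵥ (h u)) ≡ (1ℚ + 1ℚ) * (a i * α + - α + a i * B)
    ∑-resolved = begin
      ∑ᵥ (λ u → ∑ᵥ (h u))                                      ≡⟨ ∑-cong (allFin N) row ⟩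
      ∑ᵥ (λ u → g-row (part u) + ind (eqF u w) Δ)              ≡⟨ row-shape g-row Δ ⟩
      (a i * g-row i + sumOthers i (λ t → a t * g-row t)) + Δ
        ≡⟨ cong₂ (λ x y → (a i * x + y) + Δ) (if-refl (α + B)) (trans (sumOthers-cong i off-i) (sumOthers-* i (a i) _)) ⟩
      (a i * (α + B) + a i * B) + Δ
        ≡⟨ solve 3 (λ A α B → (A :* (α :+ B) :+ A :* B) :+ (A :* α :+ :- α :+ :- α)
                               := (con 1ℚ :+ con 1ℚ) :* (A :* α :+ :- α :+ A :* B)) refl (a i) α B ⟩
      (1ℚ + 1ℚ) * (a i * α + - α + a i * B) ∎
      where
      open ≡-Reasoning
      off-i : ∀ t → t ≢ i → a t * g-row t ≡ a i * (a t * β i t)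
      off-i t t≢i rewrite eqF-≢ t≢i | β-sym t i =
        solve 3 (λ x y z → x :* (y :* z) := y :* (x :* z)) refl (a t) (a i) (β i t)

  ½ : ℚ
  ½ = inv (1ℚ + 1ℚ)

  -- r(u,v) = 1/|R(u,v)| whenever w resolves u, v
  share : Fin N → Fin N → ℚ
  share u v = 1 ÷ℕ sizeR G u v

  private
    1÷ℕ : ∀ m → 1 ÷ℕ m ≡ inv (ℕ→ℚ m)
    1÷ℕ m = trans (÷ℕ≡*inv 1 m) (ℚP.*-identityˡ _)

  share-mate : ∀ {u v} → u ≢ v → part u ≡ part v → share u v ≡ ½
  share-mate {u} {v} u≢v u∼v = trans (1÷ℕ (sizeR G u v)) (cong inv (|R|-mate u≢v u∼v))

  share-cross : ∀ {u v} → part u ≢ part v → share u v ≡ inv (a (part u) + a (part v))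
  share-cross {u} {v} u≁v = trans (1÷ℕ (sizeR G u v)) (cong inv (|R|-cross u≁v))

  others : Fin k → ℚ
  others i = sumOthers i (λ t → a t * 1ℚ)

  others-shares : Fin k → ℚ
  others-shares i = sumOthers i (λ t → a t * inv (a i + a t))

  ar-part : Fin k → ℚ
  ar-part i = inv (a i * 1ℚ + - 1ℚ + a i * others i) * (a i * ½ + - ½ + a i * others-shares i)

  module _ (w : Fin N) where

    private
      i : Fin k
      i = part w

      resolved-by-w : Fin N × Fin N → Bool
      resolved-by-w p = resolves G w (proj₁ p) (proj₂ p)

      R-sum : ∀ f → ∑ (Rw G w) f ≡ ∑ (Vp G) (λ p → ind (resolved-by-w p) (f p))
      R-sum f = trans (∑-filter (λ p → resolved-by-w p Bool.≟ true) (Vp G) f)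
        (∑-cong (Vp G) (λ p → cong (λ b → ind b (f p)) (does-≟true (resolved-by-w p))))

    |R[w]| : ℕ→ℚ (length (Rw G w)) ≡ a i * 1ℚ + - 1ℚ + a i * others i
    |R[w]| = *-cancelˡ-nonzero (1ℚ + 1ℚ) two≢0 (begin
      (1ℚ + 1ℚ) * ℕ→ℚ (length (Rw G w))
        ≡⟨ cong ((1ℚ + 1ℚ) *_) (trans (length-filter (λ p → resolved-by-w p Bool.≟ true) (Vp G))
                                      (∑-cong (Vp G) (λ p → cong (λ b → ind b 1ℚ) (does-≟true (resolved-by-w p))))) ⟩
      (1ℚ + 1ℚ) * ∑ (Vp G) (λ p → ind (resolved-by-w p) 1ℚ)
        ≡⟨ ∑-ordered-pairs G (λ u v → ind (resolves G w u v) 1ℚ)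
             (λ u v → cong (λ b → ind b 1ℚ) (resolves-sym G w u v))
             (λ u → cong (λ b → ind b 1ℚ) (resolves-diag G w u)) ⟨
      ∑ (allFin N) (λ u → ∑ (allFin N) (λ v → ind (resolves G w u v) 1ℚ))
        ≡⟨ WeightedResolvedPairs.∑-resolved w 1ℚ (λ _ _ → 1ℚ) (λ _ _ → 1ℚ) (λ _ _ → refl) (λ _ → refl) (λ _ _ → refl) ⟩
      (1ℚ + 1ℚ) * (a i * 1ℚ + - 1ℚ + a i * others i) ∎)
      where open ≡-Reasoning

    ∑-shares : ∑ (Rw G w) (λ p → rshare G w (proj₁ p) (proj₂ p)) ≡ a i * ½ + - ½ + a i * others-shares i
    ∑-shares = *-cancelˡ-nonzero (1ℚ + 1ℚ) two≢0 (begin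
      (1ℚ + 1ℚ) * ∑ (Rw G w) (λ p → rshare G w (proj₁ p) (proj₂ p))
        ≡⟨ cong ((1ℚ + 1ℚ) *_) (trans (R-sum _) (∑-cong (Vp G) (λ p → ind-idem (resolved-by-w p) _))) ⟩
      (1ℚ + 1ℚ) * ∑ (Vp G) (λ p → ind (resolved-by-w p) (share (proj₁ p) (proj₂ p)))
        ≡⟨ ∑-ordered-pairs G (λ u v → ind (resolves G w u v) (share u v))
             (λ u v → cong₂ ind (resolves-sym G w u v) (share-sym u v))
             (λ u → cong (λ b → ind b (share u u)) (resolves-diag G w u)) ⟨
      ∑ (allFin N) (λ u → ∑ (allFin N) (λ v → ind (resolves G w u v) (share u v)))
        ≡⟨ WeightedResolvedPairs.∑-resolved w ½ (λ s t → inv (a s + a t)) share share-mate share-cross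
             (λ s t → cong inv (ℚP.+-comm (a s) (a t))) ⟩
      (1ℚ + 1ℚ) * (a i * ½ + - ½ + a i * others-shares i) ∎)
      where
      open ≡-Reasoning
      share-sym : ∀ u v → share u v ≡ share v u
      share-sym u v = trans (1÷ℕ (sizeR G u v)) (trans (cong inv (|R|-sym G u v)) (sym (1÷ℕ (sizeR G v u))))

    ar-value : ar G w ≡ ar-part i
    ar-value = cong₂ _*_ (trans (1÷ℕ (length (Rw G w))) (cong inv |R[w]|)) ∑-shares

  index-by-parts : resolvingIndex G ≡ ∑ (allFin k) (λ t → a t * ar-part t)
  index-by-parts = trans (∑-cong (allFin N) ar-value) (∑-parts ar-part)

  -- Each summand of the formula is n_i · ar-part i: with n_i = 1 + M,
  -- numerator and denominator of ar-part i both carry the factor n_i.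
  summand-value : ∀ i → 1 ≤ n i → a i * ar-part i ≡ formula-term n i
  summand-value i 1≤nᵢ = sym (begin
    formula-term n i
      ≡⟨ cong₂ (λ x y → A * inv x * y) (cong₂ _+_ first-ratio (sumOthers-cong i (λ t _ → sym (ℚP.*-identityʳ (a t)))))
                                       (cong₂ _+_ second-ratio (sumOthers-cong i (λ t _ → cross-ratio t))) ⟩
    A * inv X * Y                                            ≡⟨ ℚP.*-assoc A (inv X) Y ⟩
    A * (inv X * Y)                                          ≡⟨ cong (A *_) (cancel-ratio A X Y A≢0) ⟨
    A * (inv (A * X) * (A * Y))
      ≡⟨ cong₂ (λ x y → A * (inv x * y)) (scale-out {A} {M} 1ℚ (others i) A≡1+M A≢0)
                                         (scale-out {A} {M} ½ (others-shares i) A≡1+M A≢0) ⟨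
    A * ar-part i                                            ∎)
    where
    open ≡-Reasoning
    A M X Y : ℚ
    A = a i
    M = ℕ→ℚ (n i ℕ.∸ 1)
    X = M * (1ℚ * inv A) + others i
    Y = M * (½ * inv A) + others-shares i
    n≡1+m : n i ≡ suc (n i ℕ.∸ 1)
    n≡1+m = sym (ℕP.m+[n∸m]≡n 1≤nᵢ)
    A≡1+M : A ≡ 1ℚ + M
    A≡1+M = trans (cong ℕ→ℚ n≡1+m) (ℕ→ℚ-+ 1 (n i ℕ.∸ 1))
    A≢0 : A ≢ 0ℚ
    A≢0 A≡0 = ℕ→ℚ-suc≢0 (n i ℕ.∸ 1) (trans (cong ℕ→ℚ (sym n≡1+m)) A≡0)
    first-ratio : (n i ℕ.∸ 1) ÷ℕ n i ≡ M * (1ℚ * inv A)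
    first-ratio = trans (÷ℕ≡*inv (n i ℕ.∸ 1) (n i)) (cong (M *_) (sym (ℚP.*-identityˡ (inv A))))
    double : ℕ→ℚ (2 ℕ.* n i) ≡ (1ℚ + 1ℚ) * A
    double = trans (ℕ→ℚ-+ (n i) (n i ℕ.+ 0)) (trans (cong (_+_ A) (ℕ→ℚ-+ (n i) 0))
      (solve 1 (λ x → x :+ (x :+ con 0ℚ) := (con 1ℚ :+ con 1ℚ) :* x) refl A))
    second-ratio : (n i ℕ.∸ 1) ÷ℕ (2 ℕ.* n i) ≡ M * (½ * inv A)
    second-ratio = trans (÷ℕ≡*inv (n i ℕ.∸ 1) (2 ℕ.* n i))
      (cong (M *_) (trans (cong inv double) (inv-* (1ℚ + 1ℚ) A two≢0)))
    cross-ratio : ∀ t → n t ÷ℕ (n i ℕ.+ n t) ≡ a t * inv (a i + a t)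
    cross-ratio t = trans (÷ℕ≡*inv (n t) (n i ℕ.+ n t)) (cong (λ z → a t * inv z) (ℕ→ℚ-+ (n i) (n t)))

countF-witness : ∀ {N} (P : Fin N → Bool) → countF P ≢ 0 → ∃ λ x → P x ≡ true
countF-witness {N} P = search (allFin N)
  where
  search : ∀ xs → length (filter (λ x → P x Bool.≟ true) xs) ≢ 0 → ∃ λ x → P x ≡ true
  search []       count≢0 = contradiction refl count≢0
  search (x ∷ xs) count≢0 with P x in Px
  ... | true  = x , Px
  ... | false = search xs count≢0

eqF-true : ∀ {n} {x y : Fin n} → eqF x y ≡ true → x ≡ y
eqF-true {x = x} {y} x≟y with x ≟ᶠ y
... | yes x≡y = x≡y

spread-of : ∀ {N k} (part : Fin N → Fin (suc (suc k))) → (∀ t → partSize part t ≢ 0) → Spread part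
spread-of part nonempty u with another (part u)
  where
  another : ∀ {k} (t : Fin (suc (suc k))) → ∃ λ s → s ≢ t
  another Fin.zero    = Fin.suc Fin.zero , λ ()
  another (Fin.suc _) = Fin.zero , λ ()
... | s , s≢u with countF-witness (λ x → eqF (part x) s) (nonempty s)
... | x , x∈s = x , λ x∼u → s≢u (trans (sym (eqF-true x∈s)) x∼u)

theorem3p10 : (k : ℕ) → 2 ≤ k → (n : Fin k → ℕ) → (∀ i → 2 ≤ n i) →
    (N : ℕ) (part : Fin N → Fin k) → (∀ i → partSize part i ≡ n i) →
    resolvingIndex (completeMultipartite part) ≡ formula n
theorem3p10 _ (s≤s (s≤s z≤n)) n n≥2 N part sizes = begin
  resolvingIndex (completeMultipartite part)    ≡⟨ index-by-parts ⟩
  ∑ (allFin _) (λ t → a t * ar-part t)          ≡⟨ ∑-cong (allFin _) (λ t → summand-value t (ℕP.≤-trans (ℕP.n≤1+n 1) (n≥2 t))) ⟩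
  ∑ (allFin _) (formula-term n)                 ≡⟨⟩
  formula n                                     ∎
  where
  open ≡-Reasoning
  nonempty : ∀ t → partSize part t ≢ 0
  nonempty t size≡0 with () ← subst (2 ≤_) (trans (sym (sizes t)) size≡0) (n≥2 t)
  open ResolvingMultipartite part (spread-of part nonempty) n sizes
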